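{- Let $a,d$ be positive integers with $\gcd(a,d)=1$, let $k$ be an integer with $2\le k\le a-1$, and let $S=\langle a,a+d,\dots,a+kd\rangle$. Let $x\in S$. Then there exists a unique triplet $(x_0,x_i,x_k)\in\mathbb{N}\times\{0,1\}\times\{0,\dots,\lceil a/k\rceil\}$ such that $$x=x_0a+x_i(a+id)+x_k(a+kd)$$ for some $1\le i\le k-1$ with $i x_i+k x_k<a$.
   Context: $S=\langle a,a+d,\dots,a+kd\rangle$ denotes the numerical semigroup $\{\sum_{j=0}^{k} y_j(a+jd): y_j\in\mathbb{N}\}$. $\mathbb{N}$ includes $0$. -}

module Defs where

open import Data.Nat using (ℕ; zero; suc; _+_; _*_; _/_; _≤_; _<_)
open import Data.Fin using (Fin; toℕ)
open import Data.List using (tabulate)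
open import Data.Nat.ListAction using (sum)
open import Data.Product using (Σ; ∃; _×_; _,_)
open import Relation.Binary.PropositionalEquality using (_≡_)

-- ⌈ a / k ⌉ for k ≥ 1 (value at k = 0 is irrelevant; k ≥ 2 in the statement)
ceilDiv : ℕ → ℕ → ℕ
ceilDiv a zero = zero
ceilDiv a (suc m) = (a + m) / suc m

InS : ℕ → ℕ → ℕ → ℕ → Set
InS a d k x = Σ (Fin (suc k) → ℕ) λ y →
  x ≡ sum (tabulate {n = suc k} (λ j → y j * (a + toℕ j * d)))

Rep : ℕ → ℕ → ℕ → ℕ → ℕ × ℕ × ℕ → Set
Rep a d k x (x₀ , xi , xk) =
  xi ≤ 1 × xk ≤ ceilDiv a k ×
  ∃ λ i → 1 ≤ i × suc i ≤ k ×
    x ≡ x₀ * a + xi * (a + i * d) + xk * (a + k * d) ×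
    i * xi + k * xk < a

-- Every element of S is N a + M d where N counts the generators used and M ≤ k N is the
-- sum of their indices. Trading a copies of d for d copies of a makes M < a, and then
-- writing M = r + k q with r < k gives x_k = q, while r is absorbed by at most one
-- generator a + r d. Since gcd(a,d) = 1, the pair (N, M) with M < a is determined by
-- x, and so is the triple, by uniqueness of division with remainder.
module Submission where

open import Defs
open import Data.Nat using (ℕ; zero; suc; _+_; _*_; _∸_; _/_; _%_; _≤_; _<_; z≤n; s≤s; z<s; NonZero)
open import Data.Nat.Properties
open import Data.Nat.DivMod using (m≡m%n+[m/n]*n; m%n<n; m%n≤m; m<n⇒m%n≡m; [m+kn]%n≡m%n; /-monoˡ-≤)
open import Data.Nat.Divisibility using (_∣_; n∣m*n; ∣m+n∣m⇒∣n; n∣m⇒m%n≡0)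
open import Data.Nat.Coprimality using (Coprime; gcd≡1⇒coprime; coprime-divisor)
open import Data.Nat.GCD using (gcd)
open import Data.Nat.Tactic.RingSolver using (solve-∀)
open import Data.Fin using (Fin; toℕ)
open import Data.Fin.Properties using (toℕ<n)
open import Data.List using (tabulate)
open import Data.Nat.ListAction using (sum)
open import Data.Product using (Σ; _×_; _,_; proj₁; proj₂)
open import Data.Sum using (inj₁; inj₂)
open import Function using (_∘_)
open import Relation.Nullary using (contradiction)
open import Relation.Binary.PropositionalEquality using (_≡_; refl; sym; trans; cong; cong₂; subst; module ≡-Reasoning)

record Decomposition (a d k x : ℕ) : Set where
  constructor decomposition
  field
    N M : ℕ
    x≡Na+Md : x ≡ N * a + M * d
    M≤kN : M ≤ k * N

open Decomposition

generator-sum : ∀ a d k {n} (y g : Fin n → ℕ) → (∀ j → g j ≤ k) →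
  Decomposition a d k (sum (tabulate (λ j → y j * (a + g j * d))))
generator-sum a d k {zero} y g g≤k = decomposition 0 0 refl z≤n
generator-sum a d k {suc n} y g g≤k
  with decomposition N M eq M≤kN ← generator-sum a d k (y ∘ Fin.suc) (g ∘ Fin.suc) (g≤k ∘ Fin.suc) =
  decomposition (y₀ + N) (y₀ * g₀ + M)
    (trans (cong (y₀ * (a + g₀ * d) +_) eq) (regroup y₀ g₀ a d N M))
    (subst (y₀ * g₀ + M ≤_) (sym (*-distribˡ-+ k y₀ N))
      (+-mono-≤ (subst (y₀ * g₀ ≤_) (*-comm y₀ k) (*-monoʳ-≤ y₀ (g≤k Fin.zero))) M≤kN))
  where
  y₀ g₀ : ℕ
  y₀ = y Fin.zero
  g₀ = g Fin.zero
  regroup : ∀ y g a d N M → y * (a + g * d) + (N * a + M * d) ≡ (y + N) * a + (y * g + M) * d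
  regroup = solve-∀

InS⇒Decomposition : ∀ {a d k x} → InS a d k x → Decomposition a d k x
InS⇒Decomposition {a} {d} {k} (y , eq) =
  subst (Decomposition a d k) (sym eq) (generator-sum a d k y toℕ (≤-pred ∘ toℕ<n))

reduce-mod : ∀ {a d k x} .{{_ : NonZero a}} → Decomposition a d k x →
  Σ (Decomposition a d k x) (λ D → M D < a)
reduce-mod {a} {d} {k} {x} (decomposition N M eq M≤kN) =
  decomposition (N + M / a * d) (M % a) x≡ M%a≤ , m%n<n M a
  where
  open ≡-Reasoning
  regroup : ∀ N a d q r → N * a + (r + q * a) * d ≡ (N + q * d) * a + r * d
  regroup = solve-∀
  x≡ : x ≡ (N + M / a * d) * a + M % a * d
  x≡ = begin
    x                                   ≡⟨ eq ⟩
    N * a + M * d                       ≡⟨ cong (λ m → N * a + m * d) (m≡m%n+[m/n]*n M a) ⟩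
    N * a + (M % a + M / a * a) * d     ≡⟨ regroup N a d (M / a) (M % a) ⟩
    (N + M / a * d) * a + M % a * d     ∎
  M%a≤ : M % a ≤ k * (N + M / a * d)
  M%a≤ = ≤-trans (m%n≤m M a) (≤-trans M≤kN (*-monoʳ-≤ k (m≤m+n N (M / a * d))))

∣∧<⇒≡0 : ∀ {a e} .{{_ : NonZero a}} → a ∣ e → e < a → e ≡ 0
∣∧<⇒≡0 {a} {e} a∣e e<a = trans (sym (m<n⇒m%n≡m e<a)) (n∣m⇒m%n≡0 e a a∣e)

Na+Md-injective-≤ : ∀ {a d N N′ M M′} .{{_ : NonZero a}} → Coprime a d →
  M ≤ M′ → M′ < a → N * a + M * d ≡ N′ * a + M′ * d → M ≡ M′
Na+Md-injective-≤ {a} {d} {N} {N′} {M} {M′} coprime M≤M′ M′<a eq =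
  ≤-antisym M≤M′ (m∸n≡0⇒m≤n (∣∧<⇒≡0 a∣e (≤-<-trans (m∸n≤m M′ M) M′<a)))
  where
  open ≡-Reasoning
  e : ℕ
  e = M′ ∸ M
  regroup : ∀ N′ a M e d → N′ * a + (M + e) * d ≡ (N′ * a + e * d) + M * d
  regroup = solve-∀
  Na≡ : N * a ≡ N′ * a + e * d
  Na≡ = +-cancelʳ-≡ (M * d) _ _ (begin
    N * a + M * d             ≡⟨ eq ⟩
    N′ * a + M′ * d           ≡⟨ cong (λ m → N′ * a + m * d) (m+[n∸m]≡n M≤M′) ⟨
    N′ * a + (M + e) * d      ≡⟨ regroup N′ a M e d ⟩
    N′ * a + e * d + M * d    ∎)
  a∣e : a ∣ e
  a∣e = coprime-divisor coprime
    (subst (a ∣_) (*-comm e d) (∣m+n∣m⇒∣n (subst (a ∣_) Na≡ (n∣m*n N)) (n∣m*n N′)))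

Na+Md-injective : ∀ {a d N N′ M M′} .{{_ : NonZero a}} → Coprime a d →
  M < a → M′ < a → N * a + M * d ≡ N′ * a + M′ * d → N ≡ N′ × M ≡ M′
Na+Md-injective {a} {d} {N} {N′} {M} {M′} coprime M<a M′<a eq =
  *-cancelʳ-≡ N N′ a (+-cancelʳ-≡ (M * d) _ _ (trans eq (cong (λ m → N′ * a + m * d) (sym M≡M′)))) ,
  M≡M′
  where
  M≡M′ : M ≡ M′
  M≡M′ with ≤-total M M′
  ... | inj₁ M≤M′ = Na+Md-injective-≤ {N = N} {N′} coprime M≤M′ M′<a eq
  ... | inj₂ M′≤M = sym (Na+Md-injective-≤ {N = N′} {N} coprime M′≤M M<a (sym eq))

divMod-unique : ∀ {k r r′ q q′} .{{_ : NonZero k}} → r < k → r′ < k →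
  r + k * q ≡ r′ + k * q′ → r ≡ r′ × q ≡ q′
divMod-unique {k} {r} {r′} {q} {q′} r<k r′<k eq =
  r≡r′ , *-cancelˡ-≡ q q′ k (+-cancelˡ-≡ r′ _ _ (subst (λ s → s + k * q ≡ r′ + k * q′) r≡r′ eq))
  where
  open ≡-Reasoning
  r≡r′ : r ≡ r′
  r≡r′ = begin
    r                    ≡⟨ m<n⇒m%n≡m r<k ⟨
    r % k                ≡⟨ [m+kn]%n≡m%n r q k ⟨
    (r + q * k) % k      ≡⟨ cong (λ m → (r + m) % k) (*-comm q k) ⟩
    (r + k * q) % k      ≡⟨ cong (_% k) eq ⟩
    (r′ + k * q′) % k    ≡⟨ cong (λ m → (r′ + m) % k) (*-comm k q′) ⟩
    (r′ + q′ * k) % k    ≡⟨ [m+kn]%n≡m%n r′ q′ k ⟩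
    r′ % k               ≡⟨ m<n⇒m%n≡m r′<k ⟩
    r′                   ∎

indicator-injective : ∀ {i i′ x x′} → 1 ≤ i → 1 ≤ i′ → x ≤ 1 → x′ ≤ 1 → i * x ≡ i′ * x′ → x ≡ x′
indicator-injective {x = 0} {0} _ _ _ _ _ = refl
indicator-injective {x = 1} {1} _ _ _ _ _ = refl
indicator-injective {i} {i′} {0} {1} _ 1≤i′ _ _ eq =
  contradiction (trans (sym (*-zeroʳ i)) (trans eq (*-identityʳ i′))) (<⇒≢ 1≤i′)
indicator-injective {i} {i′} {1} {0} 1≤i _ _ _ eq =
  contradiction (trans (sym (*-zeroʳ i′)) (trans (sym eq) (*-identityʳ i))) (<⇒≢ 1≤i)
indicator-injective {x = suc (suc _)} _ _ (s≤s ()) _ _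
indicator-injective {x′ = suc (suc _)} _ _ _ (s≤s ()) _

indicator<k : ∀ {i k x} → suc i ≤ k → x ≤ 1 → i * x < k
indicator<k {i} i<k x≤1 = ≤-<-trans (≤-trans (*-monoʳ-≤ i x≤1) (≤-reflexive (*-identityʳ i))) i<k

Rep-expansion : ∀ a d k x₀ xi xk i →
  x₀ * a + xi * (a + i * d) + xk * (a + k * d) ≡ (x₀ + xi + xk) * a + (i * xi + k * xk) * d
Rep-expansion = solve-∀

Rep-unique : ∀ {a d k x t t′} .{{_ : NonZero a}} .{{_ : NonZero k}} → gcd a d ≡ 1 →
  Rep a d k x t → Rep a d k x t′ → t′ ≡ t
Rep-unique {a} {d} {k} {x} {x₀ , xi , xk} {x₀′ , xi′ , xk′} gcd≡1
  (xi≤1 , _ , i , 1≤i , i<k , eq , M<a) (xi′≤1 , _ , i′ , 1≤i′ , i′<k , eq′ , M′<a) =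
  sym (cong₂ _,_ x₀≡x₀′ (cong₂ _,_ xi≡xi′ xk≡xk′))
  where
  NM≡N′M′ : x₀ + xi + xk ≡ x₀′ + xi′ + xk′ × i * xi + k * xk ≡ i′ * xi′ + k * xk′
  NM≡N′M′ = Na+Md-injective (gcd≡1⇒coprime gcd≡1) M<a M′<a
    (trans (sym (Rep-expansion a d k x₀ xi xk i))
      (trans (sym eq) (trans eq′ (Rep-expansion a d k x₀′ xi′ xk′ i′))))
  rq≡r′q′ : i * xi ≡ i′ * xi′ × xk ≡ xk′
  rq≡r′q′ = divMod-unique (indicator<k i<k xi≤1) (indicator<k i′<k xi′≤1) (proj₂ NM≡N′M′)
  xi≡xi′ : xi ≡ xi′
  xi≡xi′ = indicator-injective 1≤i 1≤i′ xi≤1 xi′≤1 (proj₁ rq≡r′q′)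
  xk≡xk′ : xk ≡ xk′
  xk≡xk′ = proj₂ rq≡r′q′
  x₀≡x₀′ : x₀ ≡ x₀′
  x₀≡x₀′ = +-cancelʳ-≡ xi _ _ (+-cancelʳ-≡ xk _ _
    (trans (proj₁ NM≡N′M′) (cong₂ (λ u v → x₀′ + u + v) (sym xi≡xi′) (sym xk≡xk′))))

-- For r = 0 no generator a + i d is used and i = 1 is a dummy index.
remainder-term : ∀ {k} r → 2 ≤ k → r < k →
  Σ ℕ λ xi → Σ ℕ λ i → xi ≤ 1 × xi ≤ r × 1 ≤ i × suc i ≤ k × i * xi ≡ r
remainder-term zero 2≤k _ = 0 , 1 , z≤n , z≤n , ≤-refl , 2≤k , refl
remainder-term (suc r) _ r<k = 1 , suc r , ≤-refl , s≤s z≤n , s≤s z≤n , r<k , *-identityʳ (suc r)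

indicator+quotient≤ : ∀ {k r q N xi} .{{_ : NonZero k}} → xi ≤ 1 → xi ≤ r → r + k * q ≤ k * N → xi + q ≤ N
indicator+quotient≤ {k} {r} {q} {xi = 0} _ _ le = *-cancelˡ-≤ k (≤-trans (m≤n+m (k * q) r) le)
indicator+quotient≤ {k} {suc r} {q} {N} {1} _ _ le = *-cancelˡ-< k q N (<-≤-trans (m<n+m (k * q) z<s) le)
indicator+quotient≤ {xi = suc (suc _)} (s≤s ()) _ _

/-≤-ceilDiv : ∀ {a k n} .{{_ : NonZero k}} → n ≤ a → n / k ≤ ceilDiv a k
/-≤-ceilDiv {a} {suc m} n≤a = /-monoˡ-≤ (suc m) (≤-trans n≤a (m≤m+n a m))

Rep-from-reduced : ∀ {a d k x} .{{_ : NonZero k}} → 2 ≤ k →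
  (D : Decomposition a d k x) → M D < a → Σ (ℕ × ℕ × ℕ) (Rep a d k x)
Rep-from-reduced {a} {d} {k} {x} 2≤k (decomposition N M eq M≤kN) M<a
  with xi , i , xi≤1 , xi≤r , 1≤i , i<k , ixi≡r ← remainder-term (M % k) 2≤k (m%n<n M k) =
  (x₀ , xi , q) , xi≤1 , /-≤-ceilDiv (<⇒≤ M<a) , i , 1≤i , i<k , x≡ , subst (_< a) M≡ M<a
  where
  open ≡-Reasoning
  q x₀ : ℕ
  q = M / k
  x₀ = N ∸ (xi + q)
  M≡r+kq : M ≡ M % k + k * q
  M≡r+kq = trans (m≡m%n+[m/n]*n M k) (cong (M % k +_) (*-comm q k))
  M≡ : M ≡ i * xi + k * q
  M≡ = trans M≡r+kq (cong (_+ k * q) (sym ixi≡r))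
  N≡ : N ≡ x₀ + xi + q
  N≡ = trans (sym (m∸n+n≡m (indicator+quotient≤ xi≤1 xi≤r (subst (_≤ k * N) M≡r+kq M≤kN))))
             (sym (+-assoc x₀ xi q))
  x≡ : x ≡ x₀ * a + xi * (a + i * d) + q * (a + k * d)
  x≡ = begin
    x                                             ≡⟨ eq ⟩
    N * a + M * d                                 ≡⟨ cong₂ (λ n m → n * a + m * d) N≡ M≡ ⟩
    (x₀ + xi + q) * a + (i * xi + k * q) * d      ≡⟨ Rep-expansion a d k x₀ xi q i ⟨
    x₀ * a + xi * (a + i * d) + q * (a + k * d)   ∎

Rep-exists : ∀ {a d k x} .{{_ : NonZero a}} .{{_ : NonZero k}} → 2 ≤ k →
  InS a d k x → Σ (ℕ × ℕ × ℕ) (Rep a d k x)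
Rep-exists {a} {d} {k} {x} 2≤k x∈S = Rep-from-reduced 2≤k (proj₁ reduced) (proj₂ reduced)
  where
  reduced : Σ (Decomposition a d k x) (λ D → M D < a)
  reduced = reduce-mod (InS⇒Decomposition x∈S)

lemma4p1 : (a d k : ℕ) → 1 ≤ a → 1 ≤ d → gcd a d ≡ 1 → 2 ≤ k → k ≤ a ∸ 1 →
    (x : ℕ) → InS a d k x →
    Σ (ℕ × ℕ × ℕ) λ t → Rep a d k x t ×
    ((t′ : ℕ × ℕ × ℕ) → Rep a d k x t′ → t′ ≡ t)
lemma4p1 _ _ 1 _ _ _ (s≤s ()) _ _ _
lemma4p1 a@(suc _) d k@(suc (suc _)) _ _ gcd≡1 2≤k _ x x∈S =
  proj₁ existence , proj₂ existence , λ t′ rep′ → Rep-unique gcd≡1 (proj₂ existence) rep′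
  where
  existence : Σ (ℕ × ℕ × ℕ) (Rep a d k x)
  existence = Rep-exists 2≤k x∈S
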